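{- Let $n\in\mathbb{N}$ and let $u,v\in\mathcal{A}_n^*$ be such that $\mathrm{QR}(u)$ and $\mathrm{QR}(v)$ have the same shape. Then the hypoplactic classes $\{w\in\mathcal{A}_n^*:w\equiv_{\mathrm{hypo}}u\}$ and $\{w\in\mathcal{A}_n^*:w\equiv_{\mathrm{hypo}}v\}$ have the same cardinality.
   Context: $\mathcal{A}_n=\{1<\dots<n\}$. A ribbon diagram of shape a composition $(\alpha_1,\dots,\alpha_k)$ has $\alpha_h$ boxes in row $h$, leftmost box of each row directly below the rightmost box of the previous row. A quasi-ribbon tableau is such a diagram filled with positive integers, rows weakly increasing left to right, columns strictly increasing top to bottom. Insertion of $a$ into $T$: if no entry of $T$ is $\le a$ (or $T$ empty), create a cell $a$ with $T$ attached so its first cell is directly below $a$; if no entry is $>a$, attach a new cell $a$ directly right of the last cell of $T$; otherwise let $x$ be the last cell (along the ribbon, top-left to bottom-right) with entry $\le a$ and $z$ the next cell, and form the part of $T$ up to $x$, a new cell $a$ directly right of $x$, and the rest of $T$ from $z$ attached with $z$ directly below the new cell. $\mathrm{QR}(w)$ is obtained by successive insertion of the letters of $w$ into the empty tableau, and $u\equiv_{\mathrm{hypo}}v$ iff $\mathrm{QR}(u)=\mathrm{QR}(v)$. -}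

module Defs where

open import Data.Nat using (ℕ)
open import Data.Fin using (Fin; _≤?_)
open import Data.List using (List; []; _∷_; [_]; length; map; foldl)
open import Data.Maybe using (Maybe; just; nothing)
open import Data.Product using (_×_; _,_)
open import Relation.Nullary using (yes; no)
open import Relation.Binary.PropositionalEquality using (_≡_)

-- The alphabet A_n = {1 < ... < n} is represented by Fin n (0 < ... < n-1),
-- an order-isomorphic copy.  Words are lists of letters.
Word : ℕ → Set
Word n = List (Fin n)

-- A quasi-ribbon tableau is represented by its list of rows (top to bottom);
-- the ribbon condition (first box of a row directly below the last box of the
-- previous row) is implicit in this representation.
QRTableau : ℕ → Set
QRTableau n = List (List (Fin n))

shape : ∀ {n} → QRTableau n → List ℕ
shape = map length

-- Within a row x ∷ xs followed by rows rs: find the LAST cell of the row with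
-- entry ≤ a; if found, place a directly right of it and start the rest of the
-- ribbon (beginning with the next cell z) on a new row below a.
-- Returns (new row containing a, following rows).
insRow : ∀ {n} → Fin n → List (Fin n) → List (List (Fin n))
       → Maybe (List (Fin n) × List (List (Fin n)))
insRow a [] rs = nothing
insRow a (x ∷ xs) rs with insRow a xs rs
... | just (h , rest) = just (x ∷ h , rest)
... | nothing with x ≤? a
...   | no _ = nothing
...   | yes _ with xs
...     | [] = just (x ∷ a ∷ [] , rs)
...     | y ∷ ys = just (x ∷ a ∷ [] , (y ∷ ys) ∷ rs)

insRows : ∀ {n} → Fin n → QRTableau n → Maybe (QRTableau n)
insRows a [] = nothing
insRows a (r ∷ rs) with insRows a rs
... | just rs' = just (r ∷ rs')
... | nothing with insRow a r rs
...   | just (h , rest) = just (h ∷ rest)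
...   | nothing = nothing

-- If every entry is ≤ a, the
-- last cell ≤ a is the last cell of T and a is appended to the last row.
-- Otherwise a goes directly right of the last cell x ≤ a and the rest of T
-- from the next cell z is attached with z directly below a.
insert : ∀ {n} → Fin n → QRTableau n → QRTableau n
insert a T with insRows a T
... | just T' = T'
... | nothing = [ a ] ∷ T

QR : ∀ {n} → Word n → QRTableau n
QR = foldl (λ T a → insert a T) []

_≡hypo_ : ∀ {n} → Word n → Word n → Set
u ≡hypo v = QR u ≡ QR v

-- Read a quasi-ribbon tableau along its ribbon as a list of cells, each flagged by whether
-- it starts a new row.  The entries increase weakly, strictly across a row break, so
-- inserting a letter a places it right behind the cells ≤ a and moves the next cell to a new
-- row, and the flag sequence encodes the shape.  An insertion into one ribbon can therefore
-- be mirrored in any ribbon with the same flags: remove the cell at the same position and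
-- restore the flag it displaced.  Undoing in this way, from the last letter on, the
-- insertions of a word w with QR(w) = QR(u) inside QR(v) gives a word w′ with
-- QR(w′) = QR(v), and the same construction from QR(u) takes w′ back to w.
module Submission where

open import Defs
open import Axiom.UniquenessOfIdentityProofs using (module Decidable⇒UIP)
open import Data.Bool using (Bool; true; false)
import Data.Bool.Properties as Bool
open import Data.Empty using (⊥)
open import Data.Fin using (Fin; _≤?_; _≤_; _<_)
import Data.Fin.Properties as Fin
open import Data.List using (List; []; _∷_; [_]; map; foldr; concatMap; replicate; length; reverse)
open import Data.List.Properties
  using (∷-injectiveˡ; ∷-injectiveʳ; map-concatMap; concatMap-cong; concatMap-map; reverse-foldr; reverse-involutive)
  renaming (≡-dec to List-≡-dec)
open import Data.Maybe using (just; nothing)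
open import Data.List.Relation.Unary.Linked as Linked using (Linked; []; [-]; _∷_)
open import Data.Nat using (ℕ; zero; suc)
open import Data.Nat.Properties using (<-≤-trans; ≤-<-trans; <⇒≤; ≰⇒>; <⇒≱)
open import Data.Product using (Σ; _×_; _,_; proj₁; proj₂; map₂; uncurry)
open import Data.Product.Properties using () renaming (≡-dec to ×-≡-dec)
open import Data.Unit using (⊤)
open import Function.Base using (_∘_)
open import Function.Bundles using (_↔_; mk↔ₛ′)
open import Function.Properties.Inverse using (↔-sym; ↔-trans)
open import Relation.Binary.Definitions using (DecidableEquality)
open import Relation.Binary.PropositionalEquality hiding ([_])
open import Relation.Nullary using (yes; no; contradiction)

Fibre : {A B : Set} → (A → B) → B → Set
Fibre {A} f b = Σ A (λ a → f a ≡ b)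

fibre-≡ : {A B : Set} → DecidableEquality B → {f : A → B} {b : B} {x y : Fibre f b} →
          proj₁ x ≡ proj₁ y → x ≡ y
fibre-≡ _≟_ {x = a , p} {.a , q} refl = cong (a ,_) (Decidable⇒UIP.≡-irrelevant _≟_ p q)

-- The flag of a cell is true when the cell lies directly below its predecessor.
Cell : ℕ → Set
Cell n = Fin n × Bool

Ribbon : ℕ → Set
Ribbon n = List (Cell n)

module _ {n : ℕ} where

  RibbonStep : Bool → Fin n → Fin n → Set
  RibbonStep false x y = x ≤ y
  RibbonStep true  x y = x < y

  _⋖_ : Cell n → Cell n → Set
  (x , _) ⋖ (y , c) = RibbonStep c x y

  IsQR : Ribbon n → Set
  IsQR = Linked _⋖_

  ribbonStep⇒≤ : ∀ {x y : Fin n} c → RibbonStep c x y → x ≤ y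
  ribbonStep⇒≤ false x≤y = x≤y
  ribbonStep⇒≤ true  x<y = <⇒≤ x<y

  <⇒ribbonStep : ∀ {x y : Fin n} c → x < y → RibbonStep c x y
  <⇒ribbonStep false x<y = <⇒≤ x<y
  <⇒ribbonStep true  x<y = x<y

  flags : Ribbon n → List Bool
  flags = map proj₂

  startsRow : Ribbon n → Bool
  startsRow []            = false
  startsRow ((_ , b) ∷ _) = b

  setStart : Bool → Ribbon n → Ribbon n
  setStart b []            = []
  setStart b ((x , _) ∷ K) = (x , b) ∷ K

  setStart-startsRow : ∀ b K → setStart (startsRow K) (setStart b K) ≡ K
  setStart-startsRow b []      = refl
  setStart-startsRow b (_ ∷ _) = refl

  setStart-isQR : ∀ b {K} → IsQR K → IsQR (setStart b K)
  setStart-isQR b []      = []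
  setStart-isQR b [-]     = [-]
  setStart-isQR b (r ∷ v) = r ∷ v

  consCell : Fin n → Bool → QRTableau n → QRTableau n
  consCell x true  T        = [ x ] ∷ T
  consCell x false []       = [ x ] ∷ []
  consCell x false (r ∷ rs) = (x ∷ r) ∷ rs

  -- The flag of the first cell is ignored; ribbons of words have it false.
  toTableau : Ribbon n → QRTableau n
  toTableau []            = []
  toTableau ((x , _) ∷ K) = consCell x (startsRow K) (toTableau K)

  FirstRowNonEmpty : QRTableau n → Set
  FirstRowNonEmpty []            = ⊤
  FirstRowNonEmpty ([] ∷ _)      = ⊥
  FirstRowNonEmpty ((_ ∷ _) ∷ _) = ⊤

  toTableau-firstRowNonEmpty : ∀ K → FirstRowNonEmpty (toTableau K)
  toTableau-firstRowNonEmpty [] = _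
  toTableau-firstRowNonEmpty ((x , _) ∷ K) with startsRow K | toTableau K
  ... | true  | _     = _
  ... | false | []    = _
  ... | false | _ ∷ _ = _

  ribbonInsert : Fin n → Ribbon n → Ribbon n
  ribbonInsert a [] = (a , false) ∷ []
  ribbonInsert a ((x , b) ∷ K) with x ≤? a
  ... | yes _ = (x , b) ∷ ribbonInsert a K
  ... | no  _ = (a , false) ∷ (x , true) ∷ K

  ribbonInsert-≤ : ∀ {a x : Fin n} b K → x ≤ a → ribbonInsert a ((x , b) ∷ K) ≡ (x , b) ∷ ribbonInsert a K
  ribbonInsert-≤ {a} {x} b K x≤a with x ≤? a
  ... | yes _   = refl
  ... | no  x≰a = contradiction x≤a x≰a

  ribbonInsert-> : ∀ {a x : Fin n} b K → a < x → ribbonInsert a ((x , b) ∷ K) ≡ (a , false) ∷ (x , true) ∷ K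
  ribbonInsert-> {a} {x} b K a<x with x ≤? a
  ... | yes x≤a = contradiction x≤a (<⇒≱ a<x)
  ... | no  _   = refl

  startsRow-ribbonInsert : ∀ a K → startsRow K ≡ false → startsRow (ribbonInsert a K) ≡ false
  startsRow-ribbonInsert a [] _ = refl
  startsRow-ribbonInsert a ((x , b) ∷ K) s with x ≤? a
  ... | yes _ = s
  ... | no  _ = refl

  isQR-ribbonInsert : ∀ a K → IsQR K → IsQR (ribbonInsert a K)
  isQR-ribbonInsert a [] _ = [-]
  isQR-ribbonInsert a ((x , b) ∷ K) v with x ≤? a
  ... | no  x≰a = ≰⇒> x≰a ∷ setStart-isQR true v
  ... | yes x≤a = extend K v (isQR-ribbonInsert a K (Linked.tail v))
    where
    extend : ∀ K → IsQR ((x , b) ∷ K) → IsQR (ribbonInsert a K) → IsQR ((x , b) ∷ ribbonInsert a K)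
    extend [] _ w = x≤a ∷ w
    extend ((y , c) ∷ K) v w with y ≤? a
    ... | yes _ = Linked.head v ∷ w
    ... | no  _ = x≤a ∷ w

  isQR-ribbonInsert⁻ : ∀ a K → IsQR (ribbonInsert a K) → IsQR K
  isQR-ribbonInsert⁻ a [] _ = []
  isQR-ribbonInsert⁻ a ((x , b) ∷ K) v with x ≤? a
  ... | no  _   = setStart-isQR b (Linked.tail v)
  ... | yes x≤a = restrict K v (isQR-ribbonInsert⁻ a K (Linked.tail v))
    where
    restrict : ∀ K → IsQR ((x , b) ∷ ribbonInsert a K) → IsQR K → IsQR ((x , b) ∷ K)
    restrict [] _ _ = [-]
    restrict ((y , c) ∷ K) v w with y ≤? a
    ... | yes _ = Linked.head v ∷ w
    ... | no  _ = <⇒ribbonStep c (≤-<-trans (Linked.head v) (Linked.head (Linked.tail v))) ∷ w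

  ribbonInsert-lowerBound : ∀ {x : Fin n} {b} a K → IsQR ((x , b) ∷ ribbonInsert a K) → x ≤ a
  ribbonInsert-lowerBound a [] v = Linked.head v
  ribbonInsert-lowerBound a ((y , c) ∷ K) v with y ≤? a
  ... | yes y≤a = Fin.≤-trans (ribbonStep⇒≤ c (Linked.head v)) y≤a
  ... | no  _   = Linked.head v

  insRows-consCell-just : ∀ a x c T {T′} → insRows a T ≡ just T′ →
                          insRows a (consCell x c T) ≡ just (consCell x c T′)
  insRows-consCell-just a x true  T        eq rewrite eq = refl
  insRows-consCell-just a x false []       ()
  insRows-consCell-just a x false (r ∷ rs) eq with insRows a rs | eq
  ... | just _  | refl = refl
  ... | nothing | eq′ with insRow a r rs | eq′
  ...   | just _  | refl = refl
  ...   | nothing | ()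

  insRows-consCell-nothing : ∀ {a x : Fin n} c T → a < x → insRows a T ≡ nothing →
                             insRows a (consCell x c T) ≡ nothing
  insRows-consCell-nothing {a} {x} true T a<x eq rewrite eq with x ≤? a
  ... | yes x≤a = contradiction x≤a (<⇒≱ a<x)
  ... | no  _   = refl
  insRows-consCell-nothing {a} {x} false [] a<x _ with x ≤? a
  ... | yes x≤a = contradiction x≤a (<⇒≱ a<x)
  ... | no  _   = refl
  insRows-consCell-nothing {a} {x} false (r ∷ rs) a<x eq with insRows a rs | eq
  ... | just _  | ()
  ... | nothing | eq′ with insRow a r rs | eq′
  ...   | just _  | ()
  ...   | nothing | _ with x ≤? a
  ...     | yes x≤a = contradiction x≤a (<⇒≱ a<x)
  ...     | no  _   = refl

  insRows-consCell-new : ∀ {a x : Fin n} c T → x ≤ a → insRows a T ≡ nothing → FirstRowNonEmpty T →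
                         insRows a (consCell x c T) ≡ just ((x ∷ a ∷ []) ∷ T)
  insRows-consCell-new {a} {x} true T x≤a eq _ rewrite eq with x ≤? a
  ... | yes _   = refl
  ... | no  x≰a = contradiction x≤a x≰a
  insRows-consCell-new {a} {x} false [] x≤a _ _ with x ≤? a
  ... | yes _   = refl
  ... | no  x≰a = contradiction x≤a x≰a
  insRows-consCell-new {a} {x} false ((y ∷ r) ∷ rs) x≤a eq _ with insRows a rs | eq
  ... | just _  | ()
  ... | nothing | eq′ with insRow a (y ∷ r) rs | eq′
  ...   | just _  | ()
  ...   | nothing | _ with x ≤? a
  ...     | yes _   = refl
  ...     | no  x≰a = contradiction x≤a x≰a

  insRows-toTableau-< : ∀ {a x : Fin n} {b} K → IsQR ((x , b) ∷ K) → a < x →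
                        insRows a (toTableau ((x , b) ∷ K)) ≡ nothing
  insRows-toTableau-< [] _ a<x = insRows-consCell-nothing false [] a<x refl
  insRows-toTableau-< ((y , c) ∷ K) v a<x =
    insRows-consCell-nothing c _ a<x
      (insRows-toTableau-< K (Linked.tail v) (<-≤-trans a<x (ribbonStep⇒≤ c (Linked.head v))))

  insRows-toTableau-≤ : ∀ {a x : Fin n} {b} K → IsQR ((x , b) ∷ K) → x ≤ a →
                        insRows a (toTableau ((x , b) ∷ K)) ≡ just (toTableau ((x , b) ∷ ribbonInsert a K))
  insRows-toTableau-≤ [] _ x≤a = insRows-consCell-new false [] x≤a refl _
  insRows-toTableau-≤ {a} ((y , c) ∷ K) v x≤a with y ≤? a
  ... | yes y≤a = insRows-consCell-just a _ c _ (insRows-toTableau-≤ K (Linked.tail v) y≤a)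
  ... | no  y≰a = insRows-consCell-new c _ x≤a
                    (insRows-toTableau-< K (Linked.tail v) (≰⇒> y≰a)) (toTableau-firstRowNonEmpty ((y , c) ∷ K))

  insert-toTableau : ∀ a K → IsQR K → insert a (toTableau K) ≡ toTableau (ribbonInsert a K)
  insert-toTableau a [] _ = refl
  insert-toTableau a ((x , b) ∷ K) v with x ≤? a
  ... | yes x≤a rewrite insRows-toTableau-≤ K v x≤a = refl
  ... | no  x≰a rewrite insRows-toTableau-< K v (≰⇒> x≰a) = refl

  -- Letters are inserted from the right, so QR w corresponds to ribbon (reverse w).
  ribbon : Word n → Ribbon n
  ribbon = foldr ribbonInsert []

  ribbon-isQR : ∀ w → IsQR (ribbon w)
  ribbon-isQR []      = []
  ribbon-isQR (a ∷ w) = isQR-ribbonInsert a (ribbon w) (ribbon-isQR w)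

  startsRow-ribbon : ∀ w → startsRow (ribbon w) ≡ false
  startsRow-ribbon []      = refl
  startsRow-ribbon (a ∷ w) = startsRow-ribbonInsert a (ribbon w) (startsRow-ribbon w)

  foldr-insert≡toTableau-ribbon : ∀ w → foldr insert [] w ≡ toTableau (ribbon w)
  foldr-insert≡toTableau-ribbon []      = refl
  foldr-insert≡toTableau-ribbon (a ∷ w) = begin
    insert a (foldr insert [] w)       ≡⟨ cong (insert a) (foldr-insert≡toTableau-ribbon w) ⟩
    insert a (toTableau (ribbon w))    ≡⟨ insert-toTableau a (ribbon w) (ribbon-isQR w) ⟩
    toTableau (ribbonInsert a (ribbon w)) ∎
    where open ≡-Reasoning

  QR≡toTableau-ribbon : ∀ w → QR w ≡ toTableau (ribbon (reverse w))
  QR≡toTableau-ribbon w = trans (sym (reverse-foldr insert [] w)) (foldr-insert≡toTableau-ribbon (reverse w))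

  -- Every row start is flagged, the very first cell included.
  rowCells : List (Fin n) → Ribbon n
  rowCells []      = []
  rowCells (x ∷ r) = (x , true) ∷ map (_, false) r

  cells : QRTableau n → Ribbon n
  cells = concatMap rowCells

  cells-consCell : ∀ x c T → FirstRowNonEmpty T → cells (consCell x c T) ≡ (x , true) ∷ setStart c (cells T)
  cells-consCell x true  []            _ = refl
  cells-consCell x true  ((_ ∷ _) ∷ _) _ = refl
  cells-consCell x false []            _ = refl
  cells-consCell x false ((_ ∷ _) ∷ _) _ = refl

  cells-toTableau : ∀ K → cells (toTableau K) ≡ setStart true K
  cells-toTableau []            = refl
  cells-toTableau ((x , _) ∷ K) = begin
    cells (consCell x (startsRow K) (toTableau K))
      ≡⟨ cells-consCell x (startsRow K) (toTableau K) (toTableau-firstRowNonEmpty K) ⟩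
    (x , true) ∷ setStart (startsRow K) (cells (toTableau K))
      ≡⟨ cong (λ L → (x , true) ∷ setStart (startsRow K) L) (cells-toTableau K) ⟩
    (x , true) ∷ setStart (startsRow K) (setStart true K)
      ≡⟨ cong ((x , true) ∷_) (setStart-startsRow true K) ⟩
    (x , true) ∷ K ∎
    where open ≡-Reasoning

  toTableau-injective : ∀ {K K′} → startsRow K ≡ startsRow K′ → toTableau K ≡ toTableau K′ → K ≡ K′
  toTableau-injective {K} {K′} s eq = begin
    K                                       ≡⟨ sym (setStart-startsRow true K) ⟩
    setStart (startsRow K) (setStart true K) ≡⟨ cong₂ setStart s setStart≡ ⟩
    setStart (startsRow K′) (setStart true K′) ≡⟨ setStart-startsRow true K′ ⟩
    K′ ∎
    where
    open ≡-Reasoning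
    setStart≡ : setStart true K ≡ setStart true K′
    setStart≡ = trans (sym (cells-toTableau K)) (trans (cong cells eq) (cells-toTableau K′))

  rowStart : ℕ → List Bool
  rowStart zero    = []
  rowStart (suc l) = true ∷ replicate l false

  rowStarts : List ℕ → List Bool
  rowStarts = concatMap rowStart

  flags-rowCells : ∀ r → flags (rowCells r) ≡ rowStart (length r)
  flags-rowCells []      = refl
  flags-rowCells (_ ∷ r) = cong (true ∷_) (flags-falses r)
    where
    flags-falses : ∀ r → flags (map (_, false) r) ≡ replicate (length r) false
    flags-falses []      = refl
    flags-falses (_ ∷ r) = cong (false ∷_) (flags-falses r)

  flags-cells : ∀ T → flags (cells T) ≡ rowStarts (shape T)
  flags-cells T = begin
    flags (concatMap rowCells T)          ≡⟨ map-concatMap proj₂ rowCells T ⟩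
    concatMap (flags ∘ rowCells) T        ≡⟨ concatMap-cong flags-rowCells T ⟩
    concatMap (rowStart ∘ length) T       ≡⟨ sym (concatMap-map rowStart length T) ⟩
    concatMap rowStart (map length T)     ∎
    where open ≡-Reasoning

  flags-setStart-injective : ∀ {b} K K′ → startsRow K ≡ startsRow K′ →
                             flags (setStart b K) ≡ flags (setStart b K′) → flags K ≡ flags K′
  flags-setStart-injective []      []      _ _  = refl
  flags-setStart-injective (_ ∷ _) (_ ∷ _) s eq = cong₂ _∷_ s (∷-injectiveʳ eq)

  flags-toTableau-injective : ∀ {K K′} → startsRow K ≡ startsRow K′ →
                              shape (toTableau K) ≡ shape (toTableau K′) → flags K ≡ flags K′
  flags-toTableau-injective {K} {K′} s eq = flags-setStart-injective K K′ s (begin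
    flags (setStart true K)             ≡⟨ cong flags (sym (cells-toTableau K)) ⟩
    flags (cells (toTableau K))         ≡⟨ flags-cells (toTableau K) ⟩
    rowStarts (shape (toTableau K))     ≡⟨ cong rowStarts eq ⟩
    rowStarts (shape (toTableau K′))    ≡⟨ sym (flags-cells (toTableau K′)) ⟩
    flags (cells (toTableau K′))        ≡⟨ cong flags (cells-toTableau K′) ⟩
    flags (setStart true K′)            ∎)
    where open ≡-Reasoning

  -- uninsertAlong a K K′ follows in K′ the path that inserting a takes in K, removes the cell
  -- of K′ sitting where a would land, and gives its successor the flag of the cell of K that
  -- insertion pushed to a new row.  The last clause is unreachable when flags (ribbonInsert a K) ≡ flags K′.
  uninsertAlong : Fin n → Ribbon n → Ribbon n → Fin n × Ribbon n
  uninsertAlong a [] ((a′ , _) ∷ _) = a′ , []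
  uninsertAlong a ((x , b) ∷ K) ((x′ , b′) ∷ K′) with x ≤? a
  ... | yes _ = map₂ ((x′ , b′) ∷_) (uninsertAlong a K K′)
  ... | no  _ = x′ , setStart b K′
  uninsertAlong a _ _ = a , []

  uninsertAlong-≤ : ∀ {a x : Fin n} {b} K c L → x ≤ a →
                    uninsertAlong a ((x , b) ∷ K) (c ∷ L) ≡ map₂ (c ∷_) (uninsertAlong a K L)
  uninsertAlong-≤ {a} {x} K c L x≤a with x ≤? a
  ... | yes _   = refl
  ... | no  x≰a = contradiction x≤a x≰a

  uninsertAlong-> : ∀ {a x : Fin n} {b} K z L → a < x →
                    uninsertAlong a ((x , b) ∷ K) (z ∷ L) ≡ (proj₁ z , setStart b L)
  uninsertAlong-> {a} {x} K z L a<x with x ≤? a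
  ... | yes x≤a = contradiction x≤a (<⇒≱ a<x)
  ... | no  _   = refl

  flags-uninsertAlong : ∀ a K {K′} → flags (ribbonInsert a K) ≡ flags K′ →
                        flags K ≡ flags (proj₂ (uninsertAlong a K K′))
  flags-uninsertAlong a []            {_ ∷ _} _ = refl
  flags-uninsertAlong a ((x , b) ∷ K) {[]}    eq with x ≤? a | eq
  ... | yes _ | ()
  ... | no  _ | ()
  flags-uninsertAlong a ((x , b) ∷ K) {_ ∷ K′} eq with x ≤? a
  ... | yes _ = cong₂ _∷_ (∷-injectiveˡ eq) (flags-uninsertAlong a K (∷-injectiveʳ eq))
  ... | no  _ with K′ | eq
  ...   | _ ∷ _ | eq′ = cong (b ∷_) (∷-injectiveʳ (∷-injectiveʳ eq′))

  ribbonInsert-uninsertAlong : ∀ a K {K′} → IsQR K′ → flags (ribbonInsert a K) ≡ flags K′ →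
                               uncurry ribbonInsert (uninsertAlong a K K′) ≡ K′
  ribbonInsert-uninsertAlong a [] {_ ∷ []} _ refl = refl
  ribbonInsert-uninsertAlong a ((x , b) ∷ K) {[]} _ eq with x ≤? a | eq
  ... | yes _ | ()
  ... | no  _ | ()
  ribbonInsert-uninsertAlong a ((x , b) ∷ K) {(x′ , b′) ∷ K′} v eq with x ≤? a
  ... | yes _ with uninsertAlong a K K′ | ribbonInsert-uninsertAlong a K (Linked.tail v) (∷-injectiveʳ eq)
  ...   | u , K₂ | refl = ribbonInsert-≤ b′ K₂ (ribbonInsert-lowerBound u K₂ v)
  ribbonInsert-uninsertAlong a ((x , b) ∷ K) {(x′ , b′) ∷ K′} v eq | no _ with K′ | v | eq
  ...   | (y′ , c) ∷ K″ | v′ | eq′ with ∷-injectiveˡ eq′ | ∷-injectiveˡ (∷-injectiveʳ eq′)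
  ...     | refl | refl = ribbonInsert-> b K″ (Linked.head v′)

  uninsertAlong-ribbonInsert : ∀ a K {K′} → IsQR K′ → flags (ribbonInsert a K) ≡ flags K′ →
                               uncurry uninsertAlong (uninsertAlong a K K′) (ribbonInsert a K) ≡ (a , K)
  uninsertAlong-ribbonInsert a [] {_ ∷ _} _ _ = refl
  uninsertAlong-ribbonInsert a ((x , b) ∷ K) {[]} _ eq with x ≤? a | eq
  ... | yes _ | ()
  ... | no  _ | ()
  uninsertAlong-ribbonInsert a ((x , b) ∷ K) {(x′ , b′) ∷ K′} v eq with x ≤? a
  ... | yes _
    with uninsertAlong a K K′
       | ribbonInsert-uninsertAlong a K (Linked.tail v) (∷-injectiveʳ eq)
       | uninsertAlong-ribbonInsert a K (Linked.tail v) (∷-injectiveʳ eq)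
  ...   | u , K₂ | refl | ih =
    trans (uninsertAlong-≤ K₂ (x , b) (ribbonInsert a K) (ribbonInsert-lowerBound u K₂ v))
          (cong (map₂ ((x , b) ∷_)) ih)
  uninsertAlong-ribbonInsert a ((x , b) ∷ K) {(x′ , b′) ∷ K′} v eq | no _ with K′ | v | eq
  ...   | (y′ , c) ∷ K″ | v′ | eq′ with ∷-injectiveˡ eq′ | ∷-injectiveˡ (∷-injectiveʳ eq′)
  ...     | refl | refl = uninsertAlong-> K″ (a , false) ((x , true) ∷ K) (Linked.head v′)

  isQR-uninsertAlong : ∀ a K {K′} → IsQR K′ → flags (ribbonInsert a K) ≡ flags K′ →
                       IsQR (proj₂ (uninsertAlong a K K′))
  isQR-uninsertAlong a K v eq =
    isQR-ribbonInsert⁻ _ _ (subst IsQR (sym (ribbonInsert-uninsertAlong a K v eq)) v)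

  transfer : Word n → Ribbon n → Word n
  transfer []      _  = []
  transfer (a ∷ r) K′ = proj₁ step ∷ transfer r (proj₂ step)
    where
    step : Fin n × Ribbon n
    step = uninsertAlong a (ribbon r) K′

  ribbon-transfer : ∀ r {K′} → IsQR K′ → flags (ribbon r) ≡ flags K′ → ribbon (transfer r K′) ≡ K′
  ribbon-transfer []      {[]} _ _ = refl
  ribbon-transfer (a ∷ r) {K′} v eq = begin
    ribbonInsert u (ribbon (transfer r K₂)) ≡⟨ cong (ribbonInsert u) (ribbon-transfer r v₂ eq₂) ⟩
    ribbonInsert u K₂                       ≡⟨ ribbonInsert-uninsertAlong a (ribbon r) v eq ⟩
    K′                                      ∎
    where
    open ≡-Reasoning
    u : Fin n
    u = proj₁ (uninsertAlong a (ribbon r) K′)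
    K₂ : Ribbon n
    K₂ = proj₂ (uninsertAlong a (ribbon r) K′)
    v₂ : IsQR K₂
    v₂ = isQR-uninsertAlong a (ribbon r) v eq
    eq₂ : flags (ribbon r) ≡ flags K₂
    eq₂ = flags-uninsertAlong a (ribbon r) eq

  transfer-transfer : ∀ r {K′} → IsQR K′ → flags (ribbon r) ≡ flags K′ → transfer (transfer r K′) (ribbon r) ≡ r
  transfer-transfer []      _ _  = refl
  transfer-transfer (a ∷ r) {K′} v eq = begin
    transfer (u ∷ transfer r K₂) (ribbon (a ∷ r))
      ≡⟨ cong (λ L → continue (uninsertAlong u L (ribbon (a ∷ r)))) (ribbon-transfer r v₂ eq₂) ⟩
    continue (uninsertAlong u K₂ (ribbon (a ∷ r)))
      ≡⟨ cong continue (uninsertAlong-ribbonInsert a (ribbon r) v eq) ⟩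
    a ∷ transfer (transfer r K₂) (ribbon r)
      ≡⟨ cong (a ∷_) (transfer-transfer r v₂ eq₂) ⟩
    a ∷ r ∎
    where
    open ≡-Reasoning
    u : Fin n
    u = proj₁ (uninsertAlong a (ribbon r) K′)
    K₂ : Ribbon n
    K₂ = proj₂ (uninsertAlong a (ribbon r) K′)
    v₂ : IsQR K₂
    v₂ = isQR-uninsertAlong a (ribbon r) v eq
    eq₂ : flags (ribbon r) ≡ flags K₂
    eq₂ = flags-uninsertAlong a (ribbon r) eq
    continue : Fin n × Ribbon n → Word n
    continue (a′ , K) = a′ ∷ transfer (transfer r K₂) K

  ribbon-≡-dec : DecidableEquality (Ribbon n)
  ribbon-≡-dec = List-≡-dec (×-≡-dec Fin._≟_ Bool._≟_)

  tableau-≡-dec : DecidableEquality (QRTableau n)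
  tableau-≡-dec = List-≡-dec (List-≡-dec Fin._≟_)

  transferFibre : ∀ {K K′} → IsQR K′ → flags K ≡ flags K′ → Fibre ribbon K → Fibre ribbon K′
  transferFibre {K′ = K′} v′ eq (r , p) = transfer r K′ , ribbon-transfer r v′ (trans (cong flags p) eq)

  transferFibre-inverse : ∀ {K K′} (v : IsQR K) (v′ : IsQR K′) (eq : flags K ≡ flags K′) eq′
                          (x : Fibre ribbon K) → transferFibre v eq′ (transferFibre v′ eq x) ≡ x
  transferFibre-inverse {K′ = K′} v v′ eq eq′ (r , p) = fibre-≡ ribbon-≡-dec (begin
    transfer (transfer r K′) _          ≡⟨ cong (transfer (transfer r K′)) (sym p) ⟩
    transfer (transfer r K′) (ribbon r) ≡⟨ transfer-transfer r v′ (trans (cong flags p) eq) ⟩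
    r                                   ∎)
    where open ≡-Reasoning

  fibre↔fibre : ∀ {K K′} → IsQR K → IsQR K′ → flags K ≡ flags K′ → Fibre ribbon K ↔ Fibre ribbon K′
  fibre↔fibre v v′ eq = mk↔ₛ′ (transferFibre v′ eq) (transferFibre v (sym eq))
    (transferFibre-inverse v′ v (sym eq) eq) (transferFibre-inverse v v′ eq (sym eq))

  ≡hypo⇒ribbon≡ : ∀ (w u : Word n) → w ≡hypo u → ribbon (reverse w) ≡ ribbon (reverse u)
  ≡hypo⇒ribbon≡ w u p = toTableau-injective
    (trans (startsRow-ribbon (reverse w)) (sym (startsRow-ribbon (reverse u))))
    (trans (sym (QR≡toTableau-ribbon w)) (trans p (QR≡toTableau-ribbon u)))

  hypoClass↔fibre : (u : Word n) → Σ (Word n) (λ w → w ≡hypo u) ↔ Fibre ribbon (ribbon (reverse u))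
  hypoClass↔fibre u = mk↔ₛ′ to from to∘from from∘to
    where
    open ≡-Reasoning
    to : Σ (Word n) (λ w → w ≡hypo u) → Fibre ribbon (ribbon (reverse u))
    to (w , p) = reverse w , ≡hypo⇒ribbon≡ w u p
    from : Fibre ribbon (ribbon (reverse u)) → Σ (Word n) (λ w → w ≡hypo u)
    from (r , q) = reverse r , (begin
      QR (reverse r)                            ≡⟨ QR≡toTableau-ribbon (reverse r) ⟩
      toTableau (ribbon (reverse (reverse r)))  ≡⟨ cong (toTableau ∘ ribbon) (reverse-involutive r) ⟩
      toTableau (ribbon r)                      ≡⟨ cong toTableau q ⟩
      toTableau (ribbon (reverse u))            ≡⟨ sym (QR≡toTableau-ribbon u) ⟩
      QR u                                      ∎)
    to∘from : ∀ y → to (from y) ≡ y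
    to∘from (r , _) = fibre-≡ ribbon-≡-dec (reverse-involutive r)
    from∘to : ∀ x → from (to x) ≡ x
    from∘to (w , _) = fibre-≡ tableau-≡-dec (reverse-involutive w)

proposition8p1 : (n : ℕ) (u v : Word n) → shape (QR u) ≡ shape (QR v)
               → (Σ (Word n) (λ w → w ≡hypo u)) ↔ (Σ (Word n) (λ w → w ≡hypo v))
proposition8p1 n u v sameShape =
  ↔-trans (hypoClass↔fibre u)
    (↔-trans (fibre↔fibre (ribbon-isQR (reverse u)) (ribbon-isQR (reverse v)) sameFlags)
             (↔-sym (hypoClass↔fibre v)))
  where
  sameFlags : flags (ribbon (reverse u)) ≡ flags (ribbon (reverse v))
  sameFlags = flags-toTableau-injective
    (trans (startsRow-ribbon (reverse u)) (sym (startsRow-ribbon (reverse v))))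
    (trans (cong shape (sym (QR≡toTableau-ribbon u))) (trans sameShape (cong shape (QR≡toTableau-ribbon v))))
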